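{- Let $G=(V,E)$ be a graph with maximum degree $\Delta$, $t_m$ a positive integer, $t_c=1$, and $G'=\Psi(G,t_m)$ with special vertex $a$. If $S$ is a valid \textsc{Token Computation} schedule for $(G',t_c,t_m)$ of length $|S|<3t_m$, then $\kappa=\{v\in V: v \text{ sends to } a \text{ in } S\}$ is a dominating set of $G$ of size at most $|S|-2t_m-\Delta$.
   Context: Token Network model: undirected graph with integers $t_c,t_m$; synchronous rounds; every node starts with one token. A non-busy node holding $\ge1$ token may communicate (busy $t_m$ rounds, then one token delivered to a neighbor); a non-busy node holding $\ge2$ tokens may compute (busy $t_c$ rounds, then two tokens replaced by one). A node may receive from several neighbors in a round. A schedule is valid if all actions are legal and at its end exactly one token remains; its length $|S|$ is its number of rounds. The construction $\Psi(G,t_m)$: given $G=(V,E)$ with maximum degree $\Delta$, $G'=(V',E')$ has vertex set $V'=V\cup\{a,d^*\}\cup\beta$ where $a,d^*$ are new vertices and $\beta$ is a set of $\Delta+t_m$ new vertices, and edge set $E'=E\cup\{(a,v'):v'\in V'\setminus\{a\}\}$. -}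

module Defs where

open import Data.Nat using (ℕ; zero; suc; _+_; _*_; _∸_; _≤_; _<_; _⊔_; _≤ᵇ_; _≡ᵇ_)
open import Data.Bool using (Bool; true; false; if_then_else_; _∧_; _∨_; not)
open import Data.Fin using (Fin; toℕ; splitAt; _↑ʳ_; _↑ˡ_)
import Data.Fin as F
open import Data.Sum using (_⊎_; inj₁; inj₂)
open import Data.Product using (Σ; _×_; ∃; ∃-syntax; _,_)
open import Data.List using (List; allFin; upTo; map; foldr)
open import Data.Nat.ListAction using (sum)
open import Data.Bool.ListAction using (any)
open import Relation.Binary.PropositionalEquality using (_≡_; _≢_)
open import Relation.Nullary using (¬_)

AdjMat : ℕ → Set
AdjMat n = Fin n → Fin n → Bool

IsGraph : ∀ {n} → AdjMat n → Set
IsGraph {n} adj = (∀ u v → adj u v ≡ adj v u) × (∀ v → adj v v ≡ false)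

b2n : Bool → ℕ
b2n true  = 1
b2n false = 0

ΣV : ∀ n → (Fin n → ℕ) → ℕ
ΣV n f = sum (map f (allFin n))

countV : ∀ {n} → (Fin n → Bool) → ℕ
countV {n} p = ΣV n (λ v → b2n (p v))

degree : ∀ {n} → AdjMat n → Fin n → ℕ
degree adj v = countV (adj v)

-- maximum degree Δ (0 for the empty graph)
maxDeg : ∀ {n} → AdjMat n → ℕ
maxDeg {n} adj = foldr _⊔_ 0 (map (degree adj) (allFin n))

Dominating : ∀ {n} → AdjMat n → (Fin n → Bool) → Set
Dominating {n} adj D = ∀ v → (D v ≡ true) ⊎ (∃[ u ] (adj v u ≡ true × D u ≡ true))

-- Vertices of G' are Fin (n + (2 + (Δ + tm))):
--   v ↑ˡ _          (index < n)   : the original vertex v ∈ V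
--   n ↑ʳ 0          (index = n)   : the special vertex a
--   n ↑ʳ 1          (index = n+1) : d*
--   the remaining Δ + tm indices  : the set β

ΨSize : ∀ n → AdjMat n → ℕ → ℕ
ΨSize n adj tm = n + (2 + (maxDeg adj + tm))

orig : ∀ {n} (adj : AdjMat n) (tm : ℕ) → Fin n → Fin (ΨSize n adj tm)
orig {n} adj tm v = v ↑ˡ (2 + (maxDeg adj + tm))

aV : ∀ {n} (adj : AdjMat n) (tm : ℕ) → Fin (ΨSize n adj tm)
aV {n} adj tm = n ↑ʳ F.zero

isA : ∀ {n} (adj : AdjMat n) (tm : ℕ) → Fin (ΨSize n adj tm) → Bool
isA {n} adj tm x = toℕ x ≡ᵇ n

-- edges of G restricted to V, and edges (a, v') for all v' ≠ a
ΨAdj : ∀ {n} (adj : AdjMat n) (tm : ℕ) → AdjMat (ΨSize n adj tm)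
ΨAdj {n} adj tm x y with splitAt n x | splitAt n y
... | inj₁ u | inj₁ v = adj u v
... | _      | _      = (isA adj tm x ∧ not (isA adj tm y)) ∨ (isA adj tm y ∧ not (isA adj tm x))

data Action (N : ℕ) : Set where
  idle : Action N
  send : Fin N → Action N
  comp : Action N

record Schedule (N : ℕ) : Set where
  constructor mkSchedule
  field
    act    : ℕ → Fin N → Action N
    length : ℕ
open Schedule public

module TokenModel {N : ℕ} (adj : AdjMat N) (tc tm : ℕ) (S : Schedule N) where

  dur : Action N → ℕ
  dur idle     = 0
  dur (send _) = tm
  dur comp     = tc

  need : Action N → ℕ
  need idle     = 0
  need (send _) = 1
  need comp     = 2

  isComp : Action N → Bool
  isComp comp = true
  isComp _    = false

  sendsTo : Fin N → Action N → Bool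
  sendsTo v (send w) = toℕ w ≡ᵇ toℕ v
  sendsTo v _        = false

  -- tokens produced at the end of round s-1 (available at the start of
  -- round s) by a computation at v started in round s - tc
  compDone : ℕ → Fin N → ℕ
  compDone s v = if tc ≤ᵇ s then b2n (isComp (act S (s ∸ tc) v)) else 0

  -- tokens arriving at v at the start of round s (sent in round s - tm)
  incoming : ℕ → Fin N → ℕ
  incoming s v = if tm ≤ᵇ s then ΣV N (λ u → b2n (sendsTo v (act S (s ∸ tm) u))) else 0

  -- number of tokens held by v at the start of round t (rounds 0,1,...)
  tok : ℕ → Fin N → ℕ
  tok zero    v = 1
  tok (suc t) v = (tok t v ∸ need (act S t v)) + compDone (suc t) v + incoming (suc t) v

  record Valid : Set where
    field
      busy     : ∀ t v → act S t v ≢ idle →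
                 ∀ s → t < s → s < t + dur (act S t v) → act S s v ≡ idle
      complete : ∀ t v → act S t v ≢ idle → t + dur (act S t v) ≤ length S
      edge     : ∀ t v w → act S t v ≡ send w → adj v w ≡ true
      enough   : ∀ t v → need (act S t v) ≤ tok t v
      final    : ∃[ v ] (tok (length S) v ≡ 1 × (∀ w → w ≢ v → tok (length S) w ≡ 0))

kappa : ∀ {n} (adj : AdjMat n) (tm : ℕ) → Schedule (ΨSize n adj tm) → Fin n → Bool
kappa adj tm S v =
  any (λ t → TokenModel.sendsTo (ΨAdj adj tm) 1 tm S (aV adj tm) (act S t (orig adj tm v)))
      (upTo (length S))

module Submission where

-- No token can arrive anywhere before round t_m, so before then no node merges and
-- each node sends at most once. Since merges take t_c = 1 round and sends t_m rounds,
-- a node that merges c times and sends s times after round t_m is busy c + t_m s of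
-- the |S| − t_m remaining rounds; token conservation (arrivals + 1 = final tokens +
-- merges + sends) then gives, for every node x,
--   arrivals(x) + (t_m − 1) s ≤ final(x) + |S| − t_m.
-- Take x = a. Each vertex of κ and each vertex of {d*} ∪ β not holding the final
-- token (these Δ + t_m + 1 vertices are adjacent only to a) delivers a token to a.
-- If the final token sat at a vertex of G, a would receive Δ + t_m + 1 tokens and
-- have to pass one on after round t_m, so |S| ≥ 3 t_m; hence it does not, and the
-- inequality becomes |κ| + Δ + t_m ≤ |S| − t_m.
-- For domination, a vertex v of G must send its token, either to a (so v ∈ κ) or
-- to a neighbour u. Then u must pass a token on too; if not to a, it goes to a vertex
-- of G that must pass it on again, and three consecutive transmissions do not fit
-- into fewer than 3 t_m rounds.

open import Defs
open import Data.Nat using (ℕ; zero; suc; _+_; _*_; _∸_; _≤_; _<_; z≤n; z<s; s≤s; s<s; s≤s⁻¹; _≤ᵇ_)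
open import Data.Nat.Properties
open import Data.Nat.Induction using (<-rec)
open import Data.Nat.Tactic.RingSolver using (solve-∀)
open import Algebra.Properties.CommutativeSemigroup +-commutativeSemigroup
  using (x∙yz≈xz∙y; xy∙z≈xz∙y) renaming (interchange to +-interchange)
open import Data.Bool using (Bool; true; false; T; if_then_else_)
open import Data.Bool.Properties using (T-≡; ¬-not; ∧-identityʳ)
open import Data.Bool.ListAction using (any)
open import Data.Product using (_×_; _,_; proj₁; proj₂; ∃-syntax)
open import Data.Fin using (Fin; toℕ; splitAt; _↑ʳ_; _↑ˡ_)
import Data.Fin as F
import Data.Fin.Properties as FP
open import Data.List using (upTo)
open import Data.List.Relation.Unary.Any.Properties using (any⁺; any⁻; applyUpTo⁺; applyUpTo⁻)
open import Data.List.Properties using (map-tabulate)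
open import Data.Nat.ListAction using (sum)
open import Data.Sum using (_⊎_; inj₁; inj₂)
open import Data.Empty using (⊥; ⊥-elim)
open import Relation.Binary.PropositionalEquality
open import Relation.Nullary using (contradiction; yes; no)
open import Function using (_∘_; id; Equivalence)

if-≤ᵇ : ∀ {A : Set} {m n} (x y : A) → m ≤ n → (if m ≤ᵇ n then x else y) ≡ x
if-≤ᵇ {m = m} {n} x y m≤n with m ≤ᵇ n | ≤⇒≤ᵇ m≤n
... | true | _ = refl

if-≰ᵇ : ∀ {A : Set} {m n} (x y : A) → n < m → (if m ≤ᵇ n then x else y) ≡ y
if-≰ᵇ {m = m} {n} x y n<m with m ≤ᵇ n in eq
... | true  = contradiction (≤ᵇ⇒≤ m n (subst T (sym eq) _)) (<⇒≱ n<m)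
... | false = refl

sumFrom : ℕ → ℕ → (ℕ → ℕ) → ℕ
sumFrom s zero    f = 0
sumFrom s (suc d) f = f s + sumFrom (suc s) d f

sumFrom-split : ∀ s a b f → sumFrom s (a + b) f ≡ sumFrom s a f + sumFrom (s + a) b f
sumFrom-split s zero    b f rewrite +-identityʳ s = refl
sumFrom-split s (suc a) b f rewrite sumFrom-split (suc s) a b f | +-suc s a =
  sym (+-assoc (f s) _ _)

sumFrom-snoc : ∀ s d f → sumFrom s (suc d) f ≡ sumFrom s d f + f (s + d)
sumFrom-snoc s d f = begin
  sumFrom s (suc d) f                ≡⟨ cong (λ m → sumFrom s m f) (+-comm 1 d) ⟩
  sumFrom s (d + 1) f                ≡⟨ sumFrom-split s d 1 f ⟩
  sumFrom s d f + (f (s + d) + 0)    ≡⟨ cong (sumFrom s d f +_) (+-identityʳ _) ⟩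
  sumFrom s d f + f (s + d)          ∎
  where open ≡-Reasoning

sumFrom-cong : ∀ s d {f g} → (∀ i → f i ≡ g i) → sumFrom s d f ≡ sumFrom s d g
sumFrom-cong s zero    f≗g = refl
sumFrom-cong s (suc d) f≗g = cong₂ _+_ (f≗g s) (sumFrom-cong (suc s) d f≗g)

sumFrom-distrib-+ : ∀ s d f g → sumFrom s d (λ i → f i + g i) ≡ sumFrom s d f + sumFrom s d g
sumFrom-distrib-+ s zero    f g = refl
sumFrom-distrib-+ s (suc d) f g rewrite sumFrom-distrib-+ (suc s) d f g =
  +-interchange (f s) (g s) (sumFrom (suc s) d f) (sumFrom (suc s) d g)

*-distribˡ-sumFrom : ∀ c s d f → c * sumFrom s d f ≡ sumFrom s d (λ i → c * f i)
*-distribˡ-sumFrom c s zero    f = *-zeroʳ c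
*-distribˡ-sumFrom c s (suc d) f =
  trans (*-distribˡ-+ c (f s) _) (cong (c * f s +_) (*-distribˡ-sumFrom c (suc s) d f))

sumFrom-≡0 : ∀ s d f → (∀ i → s ≤ i → i < s + d → f i ≡ 0) → sumFrom s d f ≡ 0
sumFrom-≡0 s zero    f f≡0 = refl
sumFrom-≡0 s (suc d) f f≡0 rewrite +-suc s d =
  cong₂ _+_ (f≡0 s ≤-refl (s<s (m≤m+n s d)))
            (sumFrom-≡0 (suc s) d f (λ i s<i i<s+d → f≡0 i (<⇒≤ s<i) i<s+d))

term≤sumFrom : ∀ s d f i → s ≤ i → i < s + d → f i ≤ sumFrom s d f
term≤sumFrom s zero    f i s≤i i<s = contradiction (subst (i <_) (+-identityʳ s) i<s) (≤⇒≯ s≤i)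
term≤sumFrom s (suc d) f i s≤i i<s+d with m≤n⇒m<n∨m≡n s≤i
... | inj₂ refl = m≤m+n (f s) _
... | inj₁ s<i  = ≤-trans (term≤sumFrom (suc s) d f i s<i (subst (i <_) (+-suc s d) i<s+d))
                          (m≤n+m _ (f s))

ΣV-suc : ∀ n f → ΣV (suc n) f ≡ f F.zero + ΣV n (λ i → f (F.suc i))
ΣV-suc n f = cong (λ xs → f F.zero + sum xs)
  (trans (map-tabulate F.suc f) (sym (map-tabulate id (λ i → f (F.suc i)))))

ΣV-0 : ∀ n → ΣV n (λ _ → 0) ≡ 0
ΣV-0 zero    = refl
ΣV-0 (suc n) = trans (ΣV-suc n (λ _ → 0)) (ΣV-0 n)

ΣV-distrib-+ : ∀ n f g → ΣV n (λ u → f u + g u) ≡ ΣV n f + ΣV n g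
ΣV-distrib-+ zero    f g = refl
ΣV-distrib-+ (suc n) f g
  rewrite ΣV-suc n (λ u → f u + g u) | ΣV-suc n f | ΣV-suc n g
        | ΣV-distrib-+ n (λ i → f (F.suc i)) (λ i → g (F.suc i)) =
  +-interchange (f F.zero) (g F.zero) (ΣV n (λ i → f (F.suc i))) (ΣV n (λ i → g (F.suc i)))

term≤ΣV : ∀ n f u → f u ≤ ΣV n f
term≤ΣV (suc n) f F.zero    rewrite ΣV-suc n f = m≤m+n _ _
term≤ΣV (suc n) f (F.suc u) rewrite ΣV-suc n f =
  ≤-trans (term≤ΣV n (λ i → f (F.suc i)) u) (m≤n+m _ _)

ΣV-mono-≤ : ∀ n {f g} → (∀ u → f u ≤ g u) → ΣV n f ≤ ΣV n g
ΣV-mono-≤ zero            f≤g = z≤n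
ΣV-mono-≤ (suc n) {f} {g} f≤g rewrite ΣV-suc n f | ΣV-suc n g =
  +-mono-≤ (f≤g F.zero) (ΣV-mono-≤ n (λ u → f≤g (F.suc u)))

ΣV-split : ∀ m k f → ΣV (m + k) f ≡ ΣV m (λ i → f (i ↑ˡ k)) + ΣV k (λ j → f (m ↑ʳ j))
ΣV-split zero    k f = refl
ΣV-split (suc m) k f
  rewrite ΣV-suc (m + k) f | ΣV-suc m (λ i → f (i ↑ˡ k))
        | ΣV-split m k (λ i → f (F.suc i)) =
  sym (+-assoc (f F.zero) _ _)

countV-all : ∀ m (p : Fin m → Bool) → (∀ j → p j ≡ true) → countV p ≡ m
countV-all zero    p all-p = refl
countV-all (suc m) p all-p rewrite ΣV-suc m (λ v → b2n (p v)) | all-p F.zero =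
  cong suc (countV-all m (λ j → p (F.suc j)) (λ j → all-p (F.suc j)))

countV-all-but-one : ∀ m (p : Fin m → Bool) j₀ → (∀ j → j ≢ j₀ → p j ≡ true) →
                     m ≤ suc (countV p)
countV-all-but-one (suc m) p F.zero all-p rewrite ΣV-suc m (λ v → b2n (p v)) =
  s≤s (subst (_≤ b2n (p F.zero) + countV (λ j → p (F.suc j)))
             (countV-all m _ (λ j → all-p (F.suc j) (λ ())))
             (m≤n+m _ _))
countV-all-but-one (suc m) p (F.suc j₀) all-p
  rewrite ΣV-suc m (λ v → b2n (p v)) | all-p F.zero (λ ()) =
  s≤s (countV-all-but-one m (λ j → p (F.suc j)) j₀
         (λ j j≢j₀ → all-p (F.suc j) (j≢j₀ ∘ FP.suc-injective)))

sumFrom-ΣV-comm : ∀ n s d (h : ℕ → Fin n → ℕ) →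
                  sumFrom s d (λ r → ΣV n (h r)) ≡ ΣV n (λ u → sumFrom s d (λ r → h r u))
sumFrom-ΣV-comm n s zero    h = sym (ΣV-0 n)
sumFrom-ΣV-comm n s (suc d) h =
  trans (cong (ΣV n (h s) +_) (sumFrom-ΣV-comm n (suc s) d h))
        (sym (ΣV-distrib-+ n (h s) (λ u → sumFrom (suc s) d (λ r → h r u))))

isSend : ∀ {N} → Action N → Bool
isSend (send _) = true
isSend _        = false

module ValidSchedule {N : ℕ} (G : AdjMat N) (k : ℕ) (S : Schedule N)
                     (valid : TokenModel.Valid G 1 (suc k) S) where
  open TokenModel G 1 (suc k) S
  open TokenModel.Valid valid

  tm L : ℕ
  tm = suc k
  L  = length S

  computes sends spent arrives : Fin N → ℕ → ℕ
  computes x r = b2n (isComp (act S r x))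
  sends    x r = b2n (isSend (act S r x))
  spent    x r = computes x r + sends x r
  -- tokens reaching x at the end of round r, usable from round r + 1
  arrives  x r = incoming (suc r) x

  need-≡ : ∀ (a : Action N) → need a ≡ b2n (isComp a) + b2n (isComp a) + b2n (isSend a)
  need-≡ idle     = refl
  need-≡ (send _) = refl
  need-≡ comp     = refl

  action-balance : ∀ (a : Action N) m i → need a ≤ m →
                   (m ∸ need a) + b2n (isComp a) + i + (b2n (isComp a) + b2n (isSend a)) ≡ m + i
  action-balance a m i need≤m = begin
    (m ∸ need a) + c + i + (c + s)  ≡⟨ regroup (m ∸ need a) c i s ⟩
    (m ∸ need a) + (c + c + s) + i  ≡⟨ cong (λ z → (m ∸ need a) + z + i) (need-≡ a) ⟨
    (m ∸ need a) + need a + i       ≡⟨ cong (_+ i) (m∸n+n≡m need≤m) ⟩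
    m + i                           ∎
    where
    open ≡-Reasoning
    c = b2n (isComp a)
    s = b2n (isSend a)
    regroup : ∀ r c i s → r + c + i + (c + s) ≡ r + (c + c + s) + i
    regroup = solve-∀

  tok-step : ∀ t x → tok (suc t) x + spent x t ≡ tok t x + arrives x t
  tok-step t x = action-balance (act S t x) (tok t x) (arrives x t) (enough t x)

  tok-conservation : ∀ t x → tok t x + sumFrom 0 t (spent x) ≡ 1 + sumFrom 0 t (arrives x)
  tok-conservation zero    x = refl
  tok-conservation (suc t) x = begin
    tok (suc t) x + sumFrom 0 (suc t) (spent x)          ≡⟨ cong (tok (suc t) x +_) (sumFrom-snoc 0 t (spent x)) ⟩
    tok (suc t) x + (sumFrom 0 t (spent x) + spent x t)  ≡⟨ x∙yz≈xz∙y (tok (suc t) x) _ _ ⟩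
    tok (suc t) x + spent x t + sumFrom 0 t (spent x)    ≡⟨ cong (_+ sumFrom 0 t (spent x)) (tok-step t x) ⟩
    tok t x + arrives x t + sumFrom 0 t (spent x)        ≡⟨ xy∙z≈xz∙y (tok t x) _ _ ⟨
    tok t x + sumFrom 0 t (spent x) + arrives x t        ≡⟨ cong (_+ arrives x t) (tok-conservation t x) ⟩
    1 + sumFrom 0 t (arrives x) + arrives x t            ≡⟨ cong suc (sumFrom-snoc 0 t (arrives x)) ⟨
    1 + sumFrom 0 (suc t) (arrives x)                    ∎
    where open ≡-Reasoning

  sendsTo-send : ∀ x → sendsTo x (send x) ≡ true
  sendsTo-send x = Equivalence.to T-≡ (≡⇒≡ᵇ (toℕ x) (toℕ x) refl)

  sendsTo⇒send : ∀ x a → sendsTo x a ≡ true → a ≡ send x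
  sendsTo⇒send x (send w) e = cong send (FP.toℕ-injective (≡ᵇ⇒≡ (toℕ w) (toℕ x) (Equivalence.from T-≡ e)))

  sendsDuring : Fin N → Fin N → Bool
  sendsDuring x u = any (λ t → sendsTo x (act S t u)) (upTo L)

  sendsDuring-intro : ∀ {x u} r → r < L → act S r u ≡ send x → sendsDuring x u ≡ true
  sendsDuring-intro {x} {u} r r<L sent = Equivalence.to T-≡ (any⁺ _ (applyUpTo⁺ id at-r r<L))
    where
    at-r : T (sendsTo x (act S r u))
    at-r = Equivalence.from T-≡ (trans (cong (sendsTo x) sent) (sendsTo-send x))

  sendsDuring-elim : ∀ x u → sendsDuring x u ≡ true → ∃[ r ] (r < L × act S r u ≡ send x)
  sendsDuring-elim x u e with applyUpTo⁻ id (any⁻ _ (upTo L) (Equivalence.from T-≡ e))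
  ... | r , r<L , at-r = r , r<L , sendsTo⇒send x _ (Equivalence.to T-≡ at-r)

  arrivalFrom : Fin N → ℕ → Fin N → ℕ
  arrivalFrom x r u = if tm ≤ᵇ suc r then b2n (sendsTo x (act S (suc r ∸ tm) u)) else 0

  arrives-ΣV : ∀ x r → arrives x r ≡ ΣV N (arrivalFrom x r)
  arrives-ΣV x r with tm ≤ᵇ suc r
  ... | true  = refl
  ... | false = sym (ΣV-0 N)

  arrivalFrom-send : ∀ {x u} t → act S t u ≡ send x → arrivalFrom x (t + k) u ≡ 1
  arrivalFrom-send {x} {u} t sent = begin
    arrivalFrom x (t + k) u                  ≡⟨ if-≤ᵇ _ 0 (s≤s (m≤n+m k t)) ⟩
    b2n (sendsTo x (act S (t + k ∸ k) u))   ≡⟨ cong (λ r → b2n (sendsTo x (act S r u))) (m+n∸n≡m t k) ⟩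
    b2n (sendsTo x (act S t u))             ≡⟨ cong (λ a → b2n (sendsTo x a)) sent ⟩
    b2n (sendsTo x (send x))                ≡⟨ cong b2n (sendsTo-send x) ⟩
    1                                       ∎
    where open ≡-Reasoning

  arrives≤tok : ∀ r x → arrives x r ≤ tok (suc r) x
  arrives≤tok r x = m≤n+m _ _

  arrival : ∀ {r u x} → act S r u ≡ send x → r + tm ≤ L × 1 ≤ tok (r + tm) x
  arrival {r} {u} {x} sent = completes , subst (λ t → 1 ≤ tok t x) (sym (+-suc r k)) received
    where
    completes : r + tm ≤ L
    completes = subst (λ a → r + dur a ≤ L) sent (complete r u (λ e → contradiction (trans (sym sent) e) λ ()))
    received : 1 ≤ tok (suc (r + k)) x
    received = begin
      1                                 ≡⟨ arrivalFrom-send r sent ⟨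
      arrivalFrom x (r + k) u           ≤⟨ term≤ΣV N (arrivalFrom x (r + k)) u ⟩
      ΣV N (arrivalFrom x (r + k))      ≡⟨ arrives-ΣV x (r + k) ⟨
      arrives x (r + k)                 ≤⟨ arrives≤tok (r + k) x ⟩
      tok (suc (r + k)) x               ∎
      where open ≤-Reasoning

  record SendAfter (s : ℕ) (x : Fin N) : Set where
    field
      round  : ℕ
      target : Fin N
      after  : s ≤ round
      before : round < L
      sent   : act S round x ≡ send target

  non-send-keeps-token : ∀ (a : Action N) m i → (∀ w → a ≢ send w) → need a ≤ m → 1 ≤ m →
             1 ≤ (m ∸ need a) + b2n (isComp a) + i
  non-send-keeps-token idle     m i _       _ 1≤m = ≤-trans 1≤m (≤-trans (m≤m+n m 0) (m≤m+n _ i))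
  non-send-keeps-token (send w) m i no-send _ _   = contradiction refl (no-send w)
  non-send-keeps-token comp     m i _       _ _   = ≤-trans (m≤n+m 1 (m ∸ 2)) (m≤m+n _ i)

  holds-or-sends : ∀ d s x → 1 ≤ tok s x → s + d ≤ L → SendAfter s x ⊎ 1 ≤ tok (s + d) x
  holds-or-sends zero    s x held _ = inj₂ (subst (λ t → 1 ≤ tok t x) (sym (+-identityʳ s)) held)
  holds-or-sends (suc d) s x held s+d≤L = by-action (act S s x) refl
    where
    s<L : s < L
    s<L = ≤-trans (s<s (m≤m+n s d)) (subst (_≤ L) (+-suc s d) s+d≤L)

    keep-holding : (∀ w → act S s x ≢ send w) → SendAfter s x ⊎ 1 ≤ tok (s + suc d) x
    keep-holding no-send
      with holds-or-sends d (suc s) x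
             (non-send-keeps-token (act S s x) (tok s x) (arrives x s) no-send (enough s x) held)
             (subst (_≤ L) (+-suc s d) s+d≤L)
    ... | inj₁ later = inj₁ record { SendAfter later; after = ≤-trans (n≤1+n s) (SendAfter.after later) }
    ... | inj₂ held′ = inj₂ (subst (λ t → 1 ≤ tok t x) (sym (+-suc s d)) held′)

    by-action : ∀ a → act S s x ≡ a → SendAfter s x ⊎ 1 ≤ tok (s + suc d) x
    by-action (send w) sent = inj₁ record { round = s; target = w; after = ≤-refl; before = s<L; sent = sent }
    by-action idle     eq   = keep-holding (λ w e → contradiction (trans (sym eq) e) λ ())
    by-action comp     eq   = keep-holding (λ w e → contradiction (trans (sym eq) e) λ ())

  must-send : ∀ {s x} → s ≤ L → 1 ≤ tok s x → tok L x ≡ 0 → SendAfter s x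
  must-send {s} {x} s≤L held empty
    with holds-or-sends (L ∸ s) s x held (≤-reflexive (m+[n∸m]≡n s≤L))
  ... | inj₁ sends = sends
  ... | inj₂ held′ = contradiction (subst (1 ≤_) empty (subst (λ t → 1 ≤ tok t x) (m+[n∸m]≡n s≤L) held′)) λ ()

  relays : ∀ {r u x} → act S r u ≡ send x → tok L x ≡ 0 → SendAfter (r + tm) x
  relays sent empty = must-send (proj₁ (arrival sent)) (proj₂ (arrival sent)) empty

  empty⇒tm≤L : ∀ {x} → tok L x ≡ 0 → tm ≤ L
  empty⇒tm≤L empty = ≤-trans (m≤n+m tm (SendAfter.round first)) (proj₁ (arrival (SendAfter.sent first)))
    where first = must-send z≤n (s≤s z≤n) empty

  sender≤arrivalsFrom : ∀ x u → b2n (sendsDuring x u) ≤ sumFrom 0 L (λ r → arrivalFrom x r u)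
  sender≤arrivalsFrom x u with sendsDuring x u in e
  ... | false = z≤n
  ... | true with sendsDuring-elim x u e
  ...   | t , _ , sent = subst (_≤ sumFrom 0 L (λ r → arrivalFrom x r u)) (arrivalFrom-send t sent)
                           (term≤sumFrom 0 L (λ r → arrivalFrom x r u) (t + k) z≤n
                             (subst (_≤ L) (+-suc t k) (proj₁ (arrival sent))))

  senders≤arrivals : ∀ x → ΣV N (λ u → b2n (sendsDuring x u)) ≤ sumFrom 0 L (arrives x)
  senders≤arrivals x = begin
    ΣV N (λ u → b2n (sendsDuring x u))                   ≤⟨ ΣV-mono-≤ N (sender≤arrivalsFrom x) ⟩
    ΣV N (λ u → sumFrom 0 L (λ r → arrivalFrom x r u))  ≡⟨ sumFrom-ΣV-comm N 0 L (arrivalFrom x) ⟨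
    sumFrom 0 L (λ r → ΣV N (arrivalFrom x r))           ≡⟨ sumFrom-cong 0 L (arrives-ΣV x) ⟨
    sumFrom 0 L (arrives x)                              ∎
    where open ≤-Reasoning

  duration : Fin N → ℕ → ℕ
  duration x r = dur (act S r x)

  busy-time : ∀ x d lo → lo + d ≡ L → sumFrom lo d (duration x) ≤ d
  busy-time x = <-rec (λ d → ∀ lo → lo + d ≡ L → sumFrom lo d (duration x) ≤ d) step
    where
    step : ∀ d → (∀ {d′} → d′ < d → ∀ lo → lo + d′ ≡ L → sumFrom lo d′ (duration x) ≤ d′) →
           ∀ lo → lo + d ≡ L → sumFrom lo d (duration x) ≤ d
    step zero    _   _  _   = z≤n
    step (suc d) rec lo end = by-action (act S lo x) refl
      where
      action : ∀ e → act S lo x ≢ idle → duration x lo ≡ suc e →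
               suc e + sumFrom (suc lo) d (duration x) ≤ suc d
      action e active dur≡ = begin
        suc e + sumFrom (suc lo) d (duration x)
          ≡⟨ cong (λ m → suc e + sumFrom (suc lo) m (duration x)) (m+[n∸m]≡n e≤d) ⟨
        suc e + sumFrom (suc lo) (e + (d ∸ e)) (duration x)
          ≡⟨ cong (suc e +_) (sumFrom-split (suc lo) e (d ∸ e) (duration x)) ⟩
        suc e + (sumFrom (suc lo) e (duration x) + sumFrom (suc lo + e) (d ∸ e) (duration x))
          ≡⟨ cong (λ m → suc e + (m + sumFrom (suc lo + e) (d ∸ e) (duration x))) (sumFrom-≡0 (suc lo) e _ waiting) ⟩
        suc e + sumFrom (suc lo + e) (d ∸ e) (duration x)
          ≤⟨ +-monoʳ-≤ (suc e) (rec (s≤s (m∸n≤m d e)) (suc lo + e) rest-end) ⟩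
        suc e + (d ∸ e)
          ≡⟨ cong suc (m+[n∸m]≡n e≤d) ⟩
        suc d ∎
        where
        open ≤-Reasoning
        finished : lo + suc e ≤ lo + suc d
        finished = subst₂ (λ m n → lo + m ≤ n) dur≡ (sym end) (complete lo x active)
        e≤d : e ≤ d
        e≤d = s≤s⁻¹ (+-cancelˡ-≤ lo _ _ finished)
        waiting : ∀ i → suc lo ≤ i → i < suc lo + e → duration x i ≡ 0
        waiting i lo<i i<end = cong dur (busy lo x active i lo<i
                              (subst (λ m → i < lo + m) (sym dur≡) (subst (i <_) (sym (+-suc lo e)) i<end)))
        rest-end : suc lo + e + (d ∸ e) ≡ L
        rest-end = trans (cong suc (trans (+-assoc lo e (d ∸ e)) (cong (lo +_) (m+[n∸m]≡n e≤d))))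
                         (trans (sym (+-suc lo d)) end)

      by-action : ∀ a → act S lo x ≡ a → dur a + sumFrom (suc lo) d (duration x) ≤ suc d
      by-action idle     _  = m≤n⇒m≤1+n (rec ≤-refl (suc lo) (trans (sym (+-suc lo d)) end))
      by-action (send w) eq = action k (λ e → contradiction (trans (sym eq) e) λ ()) (cong dur eq)
      by-action comp     eq = action 0 (λ e → contradiction (trans (sym eq) e) λ ()) (cong dur eq)

  one-send-per-window : ∀ d lo x → d ≤ tm → sumFrom lo d (sends x) ≤ 1
  one-send-per-window zero    lo x _    = z≤n
  one-send-per-window (suc d) lo x d<tm = by-action (act S lo x) refl
    where
    rest : sumFrom (suc lo) d (sends x) ≤ 1
    rest = one-send-per-window d (suc lo) x (<⇒≤ d<tm)

    by-action : ∀ a → act S lo x ≡ a → b2n (isSend a) + sumFrom (suc lo) d (sends x) ≤ 1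
    by-action idle     _  = rest
    by-action comp     _  = rest
    by-action (send w) eq = ≤-reflexive (cong suc (sumFrom-≡0 (suc lo) d (sends x) silent))
      where
      silent : ∀ i → suc lo ≤ i → i < suc lo + d → sends x i ≡ 0
      silent i lo<i i<end = cong (b2n ∘ isSend)
        (busy lo x (λ e → contradiction (trans (sym eq) e) λ ()) i lo<i
          (subst (λ a → i < lo + dur a) (sym eq)
            (≤-trans i<end (subst (_≤ lo + tm) (+-suc lo d) (+-monoʳ-≤ lo d<tm)))))

  no-early-computation : ∀ r x → r < tm → computes x r ≡ 0
  no-early-computation r x r<tm = by-action (act S r x) refl
    where
    no-early-arrivals : sumFrom 0 r (arrives x) ≡ 0
    no-early-arrivals = sumFrom-≡0 0 r (arrives x) (λ i _ i<r → if-≰ᵇ _ 0 (≤-<-trans i<r r<tm))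
    tok≤1 : tok r x ≤ 1
    tok≤1 = begin
      tok r x                            ≤⟨ m≤m+n (tok r x) _ ⟩
      tok r x + sumFrom 0 r (spent x)    ≡⟨ tok-conservation r x ⟩
      1 + sumFrom 0 r (arrives x)        ≡⟨ cong suc no-early-arrivals ⟩
      1                                  ∎
      where open ≤-Reasoning
    by-action : ∀ a → act S r x ≡ a → b2n (isComp a) ≡ 0
    by-action idle     _  = refl
    by-action (send _) _  = refl
    by-action comp     eq = contradiction (≤-trans (subst (λ a → need a ≤ tok r x) eq (enough r x)) tok≤1) λ { (s≤s ()) }

  duration-≡ : ∀ x i → duration x i ≡ computes x i + tm * sends x i
  duration-≡ x i with act S i x
  ... | idle   = sym (*-zeroʳ tm)
  ... | comp   = cong suc (sym (*-zeroʳ tm))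
  ... | send _ = sym (*-identityʳ tm)

  arrivals-bound : ∀ x d → tm + d ≡ L →
                   sumFrom 0 L (arrives x) + k * sumFrom tm d (sends x) ≤ tok L x + d
  arrivals-bound x d end = begin
    In + k * Sl             ≤⟨ +-monoˡ-≤ (k * Sl) In≤ ⟩
    Tₓ + (Cl + Sl) + k * Sl  ≡⟨ regroup Tₓ Cl Sl (k * Sl) ⟩
    Tₓ + (Cl + tm * Sl)      ≤⟨ +-monoʳ-≤ Tₓ late-busy ⟩
    Tₓ + d                   ∎
    where
    open ≤-Reasoning
    In = sumFrom 0 L (arrives x)
    Tₓ = tok L x
    Cl = sumFrom tm d (computes x)
    Sl = sumFrom tm d (sends x)

    regroup : ∀ t c s r → t + (c + s) + r ≡ t + (c + (s + r))
    regroup = solve-∀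

    early-spent : sumFrom 0 tm (spent x) ≤ 1
    early-spent = begin
      sumFrom 0 tm (spent x)                              ≡⟨ sumFrom-distrib-+ 0 tm (computes x) (sends x) ⟩
      sumFrom 0 tm (computes x) + sumFrom 0 tm (sends x)  ≡⟨ cong (_+ sumFrom 0 tm (sends x))
                                                               (sumFrom-≡0 0 tm _ (λ r _ → no-early-computation r x)) ⟩
      sumFrom 0 tm (sends x)                              ≤⟨ one-send-per-window tm 0 x ≤-refl ⟩
      1                                                   ∎

    spent-bound : sumFrom 0 L (spent x) ≤ 1 + (Cl + Sl)
    spent-bound = begin
      sumFrom 0 L (spent x)                              ≡⟨ cong (λ m → sumFrom 0 m (spent x)) end ⟨
      sumFrom 0 (tm + d) (spent x)                       ≡⟨ sumFrom-split 0 tm d (spent x) ⟩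
      sumFrom 0 tm (spent x) + sumFrom tm d (spent x)    ≤⟨ +-monoˡ-≤ _ early-spent ⟩
      1 + sumFrom tm d (spent x)                         ≡⟨ cong suc (sumFrom-distrib-+ tm d (computes x) (sends x)) ⟩
      1 + (Cl + Sl)                                      ∎

    In≤ : In ≤ Tₓ + (Cl + Sl)
    In≤ = s≤s⁻¹ (begin
      1 + In                      ≡⟨ tok-conservation L x ⟨
      Tₓ + sumFrom 0 L (spent x)   ≤⟨ +-monoʳ-≤ Tₓ spent-bound ⟩
      Tₓ + (1 + (Cl + Sl))         ≡⟨ +-suc Tₓ (Cl + Sl) ⟩
      1 + (Tₓ + (Cl + Sl))         ∎)

    late-busy : Cl + tm * Sl ≤ d
    late-busy = begin
      Cl + tm * Sl                                            ≡⟨ cong (Cl +_) (*-distribˡ-sumFrom tm tm d (sends x)) ⟩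
      Cl + sumFrom tm d (λ i → tm * sends x i)                ≡⟨ sumFrom-distrib-+ tm d (computes x) _ ⟨
      sumFrom tm d (λ i → computes x i + tm * sends x i)      ≡⟨ sumFrom-cong tm d (duration-≡ x) ⟨
      sumFrom tm d (duration x)                               ≤⟨ busy-time x d tm end ⟩
      d                                                       ∎

module Ψ-structure {n : ℕ} (adj : AdjMat n) (tm : ℕ) where

  K : ℕ
  K = maxDeg adj + tm

  α : Fin (ΨSize n adj tm)
  α = aV adj tm

  org : Fin n → Fin (ΨSize n adj tm)
  org = orig adj tm

  -- d* (j = 0) and the vertices of β
  leaf : Fin (suc K) → Fin (ΨSize n adj tm)
  leaf j = n ↑ʳ F.suc j

  data Vertex : Fin (ΨSize n adj tm) → Set where
    a-vertex    : Vertex α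
    leaf-vertex : ∀ j → Vertex (leaf j)
    orig-vertex : ∀ v → Vertex (org v)

  vertex : ∀ x → Vertex x
  vertex x with splitAt n x in e
  ... | inj₁ v          = subst Vertex (FP.splitAt⁻¹-↑ˡ e) (orig-vertex v)
  ... | inj₂ F.zero     = subst Vertex (FP.splitAt⁻¹-↑ʳ e) a-vertex
  ... | inj₂ (F.suc j)  = subst Vertex (FP.splitAt⁻¹-↑ʳ e) (leaf-vertex j)

  isA⇒≡α : ∀ x → isA adj tm x ≡ true → x ≡ α
  isA⇒≡α x e = FP.toℕ-injective (begin
    toℕ x                ≡⟨ ≡ᵇ⇒≡ (toℕ x) n (Equivalence.from T-≡ e) ⟩
    n                    ≡⟨ +-identityʳ n ⟨
    n + 0                ≡⟨ FP.toℕ-↑ʳ n F.zero ⟨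
    toℕ α                ∎)
    where open ≡-Reasoning

  isA-α : isA adj tm α ≡ true
  isA-α = Equivalence.to T-≡ (≡⇒≡ᵇ _ n (trans (FP.toℕ-↑ʳ n F.zero) (+-identityʳ n)))

  isA-≢ : ∀ x → toℕ x ≢ n → isA adj tm x ≡ false
  isA-≢ x x≢n = ¬-not (λ e → x≢n (≡ᵇ⇒≡ (toℕ x) n (Equivalence.from T-≡ e)))

  isA-leaf : ∀ j → isA adj tm (leaf j) ≡ false
  isA-leaf j = isA-≢ (leaf j) (>⇒≢ (begin-strict
    n                       <⟨ m<m+n n z<s ⟩
    n + suc (toℕ j)         ≡⟨ FP.toℕ-↑ʳ n (F.suc j) ⟨
    toℕ (leaf j)            ∎))
    where open ≤-Reasoning

  isA-org : ∀ v → isA adj tm (org v) ≡ false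
  isA-org v = isA-≢ (org v) (<⇒≢ (begin-strict
    toℕ (org v)             ≡⟨ FP.toℕ-↑ˡ v _ ⟩
    toℕ v                   <⟨ FP.toℕ<n v ⟩
    n                       ∎))
    where open ≤-Reasoning

  ΨAdj-leaf : ∀ j y → ΨAdj adj tm (leaf j) y ≡ isA adj tm y
  ΨAdj-leaf j y rewrite FP.splitAt-↑ʳ n (2 + K) (F.suc j) | isA-leaf j = ∧-identityʳ _

  ΨAdj-org-leaf : ∀ v j → ΨAdj adj tm (org v) (leaf j) ≡ false
  ΨAdj-org-leaf v j
    rewrite FP.splitAt-↑ˡ n v (2 + K) | FP.splitAt-↑ʳ n (2 + K) (F.suc j) | isA-leaf j | isA-org v = refl

  ΨAdj-org-org : ∀ v u → ΨAdj adj tm (org v) (org u) ≡ adj v u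
  ΨAdj-org-org v u rewrite FP.splitAt-↑ˡ n v (2 + K) | FP.splitAt-↑ˡ n u (2 + K) = refl

  leaf-neighbour : ∀ j y → ΨAdj adj tm (leaf j) y ≡ true → y ≡ α
  leaf-neighbour j y e = isA⇒≡α y (trans (sym (ΨAdj-leaf j y)) e)

  data OrigNeighbour (v : Fin n) : Fin (ΨSize n adj tm) → Set where
    a-neighbour    : OrigNeighbour v α
    orig-neighbour : ∀ {u} → adj v u ≡ true → OrigNeighbour v (org u)

  orig-neighbour-view : ∀ v y → ΨAdj adj tm (org v) y ≡ true → OrigNeighbour v y
  orig-neighbour-view v y e with vertex y
  ... | a-vertex      = a-neighbour
  ... | leaf-vertex j = contradiction (trans (sym e) (ΨAdj-org-leaf v j)) λ ()
  ... | orig-vertex u = orig-neighbour (trans (sym (ΨAdj-org-org v u)) e)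

  leaf≢α : ∀ j → leaf j ≢ α
  leaf≢α j e = contradiction (trans (trans (sym (isA-leaf j)) (cong (isA adj tm) e)) isA-α) λ ()

  org≢α : ∀ v → org v ≢ α
  org≢α v e = contradiction (trans (trans (sym (isA-org v)) (cong (isA adj tm) e)) isA-α) λ ()

  org≢leaf : ∀ v j → org v ≢ leaf j
  org≢leaf v j e = contradiction
    (trans (sym (FP.splitAt-↑ˡ n v (2 + K))) (trans (cong (splitAt n) e) (FP.splitAt-↑ʳ n (2 + K) (F.suc j))))
    λ ()

  leaf-injective : ∀ i j → leaf i ≡ leaf j → i ≡ j
  leaf-injective i j e = FP.suc-injective (FP.↑ʳ-injective n _ _ e)

module Ψ-schedule {n : ℕ} (adj : AdjMat n) (k : ℕ) (S : Schedule (ΨSize n adj (suc k)))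
                  (valid : TokenModel.Valid (ΨAdj adj (suc k)) 1 (suc k) S)
                  (short : length S < 3 * suc k) where
  open TokenModel (ΨAdj adj (suc k)) 1 (suc k) S using (tok)
  open TokenModel.Valid valid using (final; edge)
  open ValidSchedule (ΨAdj adj (suc k)) k S valid
  open Ψ-structure adj (suc k)

  ρ : Fin (ΨSize n adj tm)
  ρ = proj₁ final

  empty : ∀ x → x ≢ ρ → tok L x ≡ 0
  empty = proj₂ (proj₂ final)

  κ : Fin n → Bool
  κ = kappa adj tm S

  leafSenders : ℕ
  leafSenders = countV (λ j → sendsDuring α (leaf j))

  leaf-sends-to-a : ∀ j → leaf j ≢ ρ → sendsDuring α (leaf j) ≡ true
  leaf-sends-to-a j leaf≢ρ = sendsDuring-intro round before
    (trans sent (cong send (leaf-neighbour j target (edge round (leaf j) target sent))))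
    where open SendAfter (must-send z≤n (s≤s z≤n) (empty (leaf j) leaf≢ρ))

  κ+leaves≤arrivals : countV κ + leafSenders ≤ sumFrom 0 L (arrives α)
  κ+leaves≤arrivals = begin
    countV κ + leafSenders                                      ≤⟨ +-monoʳ-≤ (countV κ) (m≤n+m _ (f α)) ⟩
    ΣV n (f ∘ org) + (f α + ΣV (suc K) (f ∘ leaf))              ≡⟨ cong (ΣV n (f ∘ org) +_) (ΣV-suc (suc K) (λ i → f (n ↑ʳ i))) ⟨
    ΣV n (f ∘ org) + ΣV (2 + K) (λ i → f (n ↑ʳ i))              ≡⟨ ΣV-split n (2 + K) f ⟨
    ΣV (ΨSize n adj tm) f                                       ≤⟨ senders≤arrivals α ⟩
    sumFrom 0 L (arrives α)                                     ∎
    where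
    open ≤-Reasoning
    f : Fin (ΨSize n adj tm) → ℕ
    f u = b2n (sendsDuring α u)

  root-not-original : ∀ v → org v ≢ ρ
  root-not-original v org≡ρ = <⇒≱ short (begin
    3 * tm                                    ≡⟨ three-tm k ⟩
    tm + (suc tm + k)                         ≤⟨ +-monoʳ-≤ tm (+-monoˡ-≤ k (s≤s (m≤n+m tm (maxDeg adj)))) ⟩
    tm + (suc K + k)                          ≤⟨ +-monoʳ-≤ tm (+-mono-≤ leaves≤arrivals k≤k*Sl) ⟩
    tm + (sumFrom 0 L (arrives α) + k * Sl)   ≤⟨ +-monoʳ-≤ tm (subst (λ t → sumFrom 0 L (arrives α) + k * Sl ≤ t + d) a-empty (arrivals-bound α d end)) ⟩
    tm + d                                    ≡⟨ end ⟩
    L                                         ∎)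
    where
    open ≤-Reasoning
    three-tm : ∀ k → 3 * suc k ≡ suc k + (suc (suc k) + k)
    three-tm = solve-∀

    a-empty : tok L α ≡ 0
    a-empty = empty α (λ α≡ρ → org≢α v (trans org≡ρ (sym α≡ρ)))
    leaf-empty : ∀ j → leaf j ≢ ρ
    leaf-empty j leaf≡ρ = org≢leaf v j (trans org≡ρ (sym leaf≡ρ))

    d = L ∸ tm
    end : tm + d ≡ L
    end = m+[n∸m]≡n (empty⇒tm≤L a-empty)
    Sl = sumFrom tm d (sends α)

    leaves≤arrivals : suc K ≤ sumFrom 0 L (arrives α)
    leaves≤arrivals = begin
      suc K                       ≡⟨ countV-all (suc K) _ (λ j → leaf-sends-to-a j (leaf-empty j)) ⟨
      leafSenders                 ≤⟨ m≤n+m leafSenders (countV κ) ⟩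
      countV κ + leafSenders      ≤⟨ κ+leaves≤arrivals ⟩
      sumFrom 0 L (arrives α)     ∎

    late-send : 1 ≤ Sl
    late-send = subst (λ a → b2n (isSend a) ≤ Sl) sent
      (term≤sumFrom tm d (sends α) round (≤-trans (m≤n+m tm _) after) (subst (round <_) (sym end) before))
      where
      first = must-send z≤n (s≤s z≤n) (empty (leaf F.zero) (leaf-empty F.zero))
      open SendAfter (relays (trans (SendAfter.sent first) (cong send (leaf-neighbour F.zero _ (edge _ _ _ (SendAfter.sent first))))) a-empty)

    k≤k*Sl : k ≤ k * Sl
    k≤k*Sl = ≤-trans (≤-reflexive (sym (*-identityʳ k))) (*-monoʳ-≤ k late-send)

  leaves-cover : K + tok L α ≤ leafSenders
  leaves-cover = by-root (vertex ρ) refl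
    where
    by-root : ∀ {x} → Vertex x → x ≡ ρ → K + tok L α ≤ leafSenders
    by-root a-vertex α≡ρ = begin
      K + tok L α     ≡⟨ cong (K +_) (subst (λ x → tok L x ≡ 1) (sym α≡ρ) (proj₁ (proj₂ final))) ⟩
      K + 1           ≡⟨ +-comm K 1 ⟩
      suc K           ≡⟨ countV-all (suc K) _ (λ j → leaf-sends-to-a j (λ leaf≡ρ → leaf≢α j (trans leaf≡ρ (sym α≡ρ)))) ⟨
      leafSenders     ∎
      where open ≤-Reasoning
    by-root (leaf-vertex j₀) leaf≡ρ = begin
      K + tok L α     ≡⟨ cong (K +_) (empty α (λ α≡ρ → leaf≢α j₀ (trans leaf≡ρ (sym α≡ρ)))) ⟩
      K + 0           ≡⟨ +-identityʳ K ⟩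
      K               ≤⟨ s≤s⁻¹ (countV-all-but-one (suc K) _ j₀ other-leaves-send) ⟩
      leafSenders     ∎
      where
      open ≤-Reasoning
      other-leaves-send : ∀ j → j ≢ j₀ → sendsDuring α (leaf j) ≡ true
      other-leaves-send j j≢j₀ = leaf-sends-to-a j (λ e → j≢j₀ (leaf-injective j j₀ (trans e (sym leaf≡ρ))))
    by-root (orig-vertex v) org≡ρ = contradiction org≡ρ (root-not-original v)

  tm≤L : tm ≤ L
  tm≤L with α FP.≟ ρ
  ... | yes α≡ρ = empty⇒tm≤L (empty (leaf F.zero) (λ e → leaf≢α F.zero (trans e (sym α≡ρ))))
  ... | no  α≢ρ = empty⇒tm≤L (empty α α≢ρ)

  size-bound : countV κ + 2 * tm + maxDeg adj ≤ L
  size-bound = begin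
    countV κ + 2 * tm + maxDeg adj       ≡⟨ regroup (countV κ) (maxDeg adj) k ⟩
    tm + (countV κ + K)                  ≤⟨ +-monoʳ-≤ tm (+-cancelʳ-≤ (tok L α) _ _ κ+K≤d) ⟩
    tm + d                               ≡⟨ end ⟩
    L                                    ∎
    where
    open ≤-Reasoning
    regroup : ∀ c Δ k → c + 2 * suc k + Δ ≡ suc k + (c + (Δ + suc k))
    regroup = solve-∀
    d = L ∸ tm
    end : tm + d ≡ L
    end = m+[n∸m]≡n tm≤L
    κ+K≤d : countV κ + K + tok L α ≤ d + tok L α
    κ+K≤d = begin
      countV κ + K + tok L α                                 ≡⟨ +-assoc (countV κ) K (tok L α) ⟩
      countV κ + (K + tok L α)                               ≤⟨ +-monoʳ-≤ (countV κ) leaves-cover ⟩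
      countV κ + leafSenders                                 ≤⟨ κ+leaves≤arrivals ⟩
      sumFrom 0 L (arrives α)                                ≤⟨ m≤m+n _ _ ⟩
      sumFrom 0 L (arrives α) + k * sumFrom tm d (sends α)   ≤⟨ arrivals-bound α d end ⟩
      tok L α + d                                            ≡⟨ +-comm (tok L α) d ⟩
      d + tok L α                                            ∎

  data Forward (s : ℕ) (v : Fin n) : Set where
    to-a         : ∀ r → r < L → act S r (org v) ≡ send α → Forward s v
    to-neighbour : ∀ r u → s ≤ r → adj v u ≡ true → act S r (org v) ≡ send (org u) → Forward s v

  forward : ∀ {s v} → SendAfter s (org v) → Forward s v
  forward {v = v} record { round = r ; target = w ; after = s≤r ; before = r<L ; sent = sent }
    with orig-neighbour-view v w (edge r (org v) w sent)
  ... | a-neighbour        = to-a r r<L sent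
  ... | orig-neighbour v~u = to-neighbour r _ s≤r v~u sent

  orig-empty : ∀ v → tok L (org v) ≡ 0
  orig-empty v = empty (org v) (root-not-original v)

  no-three-hops : ∀ {r₀ r₁ r₂} → r₀ + tm ≤ r₁ → r₁ + tm ≤ r₂ → r₂ + tm ≤ L → ⊥
  no-three-hops {r₀} {r₁} {r₂} hop₁ hop₂ hop₃ = <⇒≱ short (begin
    3 * tm              ≡⟨ +-assoc tm tm (tm + 0) ⟨
    tm + tm + (tm + 0)  ≡⟨ cong (tm + tm +_) (+-identityʳ tm) ⟩
    tm + tm + tm        ≤⟨ +-monoˡ-≤ tm (+-monoˡ-≤ tm (≤-trans (m≤n+m tm r₀) hop₁)) ⟩
    r₁ + tm + tm        ≤⟨ +-monoˡ-≤ tm hop₂ ⟩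
    r₂ + tm             ≤⟨ hop₃ ⟩
    L                   ∎)
    where open ≤-Reasoning

  receiver-in-κ : ∀ {r₀ x u} → act S r₀ x ≡ send (org u) → κ u ≡ true
  receiver-in-κ {r₀} {u = u} sent₀ = by-forward (forward (relays sent₀ (orig-empty u)))
    where
    by-forward : Forward (r₀ + tm) u → κ u ≡ true
    by-forward (to-a r r<L sent)               = sendsDuring-intro r r<L sent
    by-forward (to-neighbour r₁ w hop₁ _ sent₁) =
      ⊥-elim (no-three-hops hop₁ (SendAfter.after third) (proj₁ (arrival (SendAfter.sent third))))
      where third = relays sent₁ (orig-empty w)

  dominating : Dominating adj κ
  dominating v = by-forward (forward (must-send z≤n (s≤s z≤n) (orig-empty v)))
    where
    by-forward : Forward 0 v → (κ v ≡ true) ⊎ ∃[ u ] (adj v u ≡ true × κ u ≡ true)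
    by-forward (to-a r r<L sent)              = inj₁ (sendsDuring-intro r r<L sent)
    by-forward (to-neighbour _ u _ v~u sent₀) = inj₂ (u , v~u , receiver-in-κ sent₀)

lemma13 : ∀ n (adj : AdjMat n) → IsGraph adj →
          ∀ (tm : ℕ) → 1 ≤ tm →
          (S : Schedule (ΨSize n adj tm)) →
          TokenModel.Valid (ΨAdj adj tm) 1 tm S →
          length S < 3 * tm →
          Dominating adj (kappa adj tm S) ×
          countV (kappa adj tm S) + 2 * tm + maxDeg adj ≤ length S
lemma13 n adj _ (suc k) (s≤s z≤n) S valid short = dominating , size-bound
  where open Ψ-schedule adj k S valid short
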